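{- For any $m\ge 4$, $${\rm dmg}'(C_m)=\begin{cases}{\rm dmg}(C_m) & \text{if } m \text{ is odd},\\ {\rm dmg}(C_m)+1 & \text{if } m \text{ is even}.\end{cases}$$ Furthermore, when $m$ is even, if the robber begins on a vertex of $C_m$ that is not adjacent to the cop's starting vertex and the cop passes during the first round, then the cop can prevent the robber from damaging more than ${\rm dmg}(C_m)$ vertices.
   Context: $C_m$ denotes the cycle on $m$ vertices. Damage game on a graph: one cop and one robber; in round $0$ the cop chooses a vertex, then the robber does; in each later round the cop moves to an adjacent vertex or passes, then the robber moves to an adjacent vertex or passes; the robber is captured if the cop occupies the robber's vertex. A vertex $v$ is damaged if the robber occupies $v$ in some round $i\ge0$ and in round $i+1$ the uncaptured robber passes or moves to a neighbour. The damage number ${\rm dmg}(\cdot)$ is the number of distinct vertices damaged when the cop plays to minimize and the robber to maximize this number. ${\rm dmg}'(H)$ is the analogous optimal-play value for the modified game in which the cop is required to pass during round $1$. (It is known that ${\rm dmg}(C_m)=\lfloor (m-1)/2\rfloor$.) -}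

module Defs where

open import Data.Nat using (ℕ; zero; suc; _≤_)
open import Data.Fin using (Fin; toℕ)
open import Data.Fin.Subset using (Subset; ⁅_⁆; _∪_; ∣_∣; ⊥)
open import Data.Product using (Σ; _×_)
open import Data.Sum using (_⊎_)
open import Relation.Binary.PropositionalEquality using (_≡_; _≢_)
open import Relation.Nullary using (¬_)

Adj : ∀ {m} → Fin m → Fin m → Set
Adj {m} i j =
  (toℕ j ≡ suc (toℕ i)) ⊎ (toℕ i ≡ suc (toℕ j))
  ⊎ ((toℕ i ≡ 0) × (suc (toℕ j) ≡ m))
  ⊎ ((toℕ j ≡ 0) × (suc (toℕ i) ≡ m))

-- Closed neighbourhood: moving to j from i is allowed (j = i means passing).
Move : ∀ {m} → Fin m → Fin m → Set
Move i j = (i ≡ j) ⊎ Adj i j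

-- Forces m k c r D : in the damage game on C_m, in the position where the
-- cop is on c, the robber on r, the set of already damaged vertices is D,
-- and the cop is about to move (start of a round i+1 ≥ 1), the robber has
-- a strategy guaranteeing that at least k distinct vertices get damaged.
-- (Reachability game, defined as the least fixed point / attractor.)
-- In a round: cop moves to c' ∈ N[c]; if c' = r the robber is captured;
-- otherwise r becomes damaged and the robber moves to r' ∈ N[r] (r' ≠ c',
-- moving onto the cop would only end the game, equivalent to passing here).
data Forces (m k : ℕ) : Fin m → Fin m → Subset m → Set where
  done : ∀ {c r D} → k ≤ ∣ D ∣ → Forces m k c r D
  step : ∀ {c r D} → c ≢ r →
         (∀ c' → Move c c' →
            (c' ≢ r) × Σ (Fin m) (λ r' → Move r r' × (r' ≢ c')
                                      × Forces m k c' r' (D ∪ ⁅ r ⁆))) →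
         Forces m k c r D

-- Modified game: in round 1 the cop is required to pass.
data Forces′ (m k : ℕ) : Fin m → Fin m → Subset m → Set where
  done : ∀ {c r D} → k ≤ ∣ D ∣ → Forces′ m k c r D
  step : ∀ {c r D} → c ≢ r →
         Σ (Fin m) (λ r' → Move r r' × (r' ≢ c) × Forces m k c r' (D ∪ ⁅ r ⁆)) →
         Forces′ m k c r D

-- Round 0: cop picks c0, then the robber picks r0 (no vertex damaged yet).
RobberForces : ℕ → ℕ → Set
RobberForces m k = ∀ (c0 : Fin m) → Σ (Fin m) (λ r0 → Forces m k c0 r0 ⊥)

RobberForces′ : ℕ → ℕ → Set
RobberForces′ m k = ∀ (c0 : Fin m) → Σ (Fin m) (λ r0 → Forces′ m k c0 r0 ⊥)

-- dmg(C_m) = k : the robber can force k damaged vertices but the cop can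
-- prevent k+1 (reachability games are determined).
IsDmg : ℕ → ℕ → Set
IsDmg m k = RobberForces m k × ¬ RobberForces m (suc k)

IsDmg′ : ℕ → ℕ → Set
IsDmg′ m k = RobberForces′ m k × ¬ RobberForces′ m (suc k)

{-# OPTIONS --safe #-}
-- On C_{2a+2} the robber starts two steps from the cop and runs away from it; the cop can
-- only stop it by going round the other way, which leaves room for a damaged vertices.  On C_{2a+1}
-- running away gives one vertex too few, so once the cop is two steps ahead the robber turns back
-- and runs to the vertex between its start and the cop's start, which is still undamaged.  When
-- the cop must pass in round 1 and m = 2a+2, the robber starts next to the cop, steps away, and
-- then runs, damaging a+1 vertices.
--
-- Say the damaged vertices form an arc reaching L steps behind and R steps ahead of the
-- robber, and the cop is x steps ahead of and y steps behind the robber.  The cop keeps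
-- L + R < B, 2L + x ≤ 2B + 1 and 2R + y ≤ 2B + 1; the last two bound the damage done by a robber
-- running forward (backward) until the cop meets it head-on.  To maintain them it steps towards the
-- robber from the side where 2L + x resp. 2R + y is larger, and passes when both are equal.  After
-- a forced pass the invariant holds if m ≤ 2B + 2 and the robber starts non-adjacent, and for
-- every start if m ≤ 2B + 1.  Matching bounds give dmg(C_m) = ⌊(m-1)/2⌋, hence dmg′(C_m).
module Submission where

open import Defs
open import Data.Nat using (ℕ; zero; suc; pred; _+_; _*_; _∸_; _≤_; _<_; _%_; _/_; z≤n; s≤s)
open import Data.Nat.Properties
open import Data.Nat.DivMod
  using (m%n<n; [m+n]%n≡m%n; [m+kn]%n≡m%n; m<n⇒m%n≡m; n%n≡0; m%n%n≡m%n; %-distribˡ-+; m≡m%n+[m/n]*n)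
open import Data.Nat.Tactic.RingSolver using (solve-∀)
open import Data.Fin using (Fin; toℕ; fromℕ<)
import Data.Fin as Fin
open import Data.Fin.Properties using (toℕ-fromℕ<; toℕ-injective; toℕ<n)
open import Data.Fin.Subset using (Subset; ⁅_⁆; _∪_; ∣_∣; ⊥; _∈_; _∉_; _⊆_; inside; outside)
open import Data.Fin.Subset.Properties
  using (x∈⁅x⁆; x∈⁅y⁆⇒x≡y; x∈p∪q⁻; p⊆p∪q; q⊆p∪q; p⊆q⇒∣p∣≤∣q∣; p⊂q⇒∣p∣<∣q∣;
         ∣p∣≤∣p∪q∣; ∣⊥∣≡0; ∉⊥; ∪-identityˡ; ∪-identityʳ; ∪-assoc)
open import Data.Vec using (_∷_)
open import Data.Product using (Σ; _×_; _,_; proj₁; proj₂; swap)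
open import Data.Sum using (_⊎_; inj₁; inj₂; [_,_])
open import Data.Empty using (⊥-elim)
open import Function using (_∘_)
open import Relation.Binary.PropositionalEquality
  using (_≡_; _≢_; refl; sym; trans; cong; cong₂; subst; ≢-sym; module ≡-Reasoning)
open import Relation.Binary.Definitions using (tri<; tri≈; tri>)
open import Relation.Nullary using (¬_; yes; no)

∣p∪⁅x⁆∣≤suc∣p∣ : ∀ {k} (p : Subset k) x → ∣ p ∪ ⁅ x ⁆ ∣ ≤ suc ∣ p ∣
∣p∪⁅x⁆∣≤suc∣p∣ (inside ∷ p) Fin.zero rewrite ∪-identityʳ p = n≤1+n _
∣p∪⁅x⁆∣≤suc∣p∣ (outside ∷ p) Fin.zero rewrite ∪-identityʳ p = ≤-refl
∣p∪⁅x⁆∣≤suc∣p∣ (inside ∷ p) (Fin.suc x) = s≤s (∣p∪⁅x⁆∣≤suc∣p∣ p x)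
∣p∪⁅x⁆∣≤suc∣p∣ (outside ∷ p) (Fin.suc x) = ∣p∪⁅x⁆∣≤suc∣p∣ p x

x∈p⇒∣p∪⁅x⁆∣≤∣p∣ : ∀ {k} (p : Subset k) {x} → x ∈ p → ∣ p ∪ ⁅ x ⁆ ∣ ≤ ∣ p ∣
x∈p⇒∣p∪⁅x⁆∣≤∣p∣ p {x} x∈p = p⊆q⇒∣p∣≤∣q∣ λ y∈ →
  [ (λ y∈p → y∈p) , (λ y∈⁅x⁆ → subst (_∈ p) (sym (x∈⁅y⁆⇒x≡y x y∈⁅x⁆)) x∈p) ] (x∈p∪q⁻ p ⁅ x ⁆ y∈)

x∉p⇒∣p∣<∣p∪⁅x⁆∣ : ∀ {k} (p : Subset k) {x} → x ∉ p → ∣ p ∣ < ∣ p ∪ ⁅ x ⁆ ∣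
x∉p⇒∣p∣<∣p∪⁅x⁆∣ p {x} x∉p = p⊂q⇒∣p∣<∣q∣ (p⊆p∪q ⁅ x ⁆ , x , q⊆p∪q p ⁅ x ⁆ (x∈⁅x⁆ x) , x∉p)

half-≤ : ∀ a b → a + a ≤ suc (b + b) → a ≤ b
half-≤ a b a+a≤ with a ≤? b
... | yes a≤b = a≤b
... | no a≰b = ⊥-elim (<⇒≱ (s≤s a+a≤) (begin
    suc (suc (b + b)) ≡⟨ cong suc (sym (+-suc b b)) ⟩
    suc b + suc b     ≤⟨ +-mono-≤ b<a b<a ⟩
    a + a             ∎))
  where
  open ≤-Reasoning
  b<a : b < a
  b<a = ≰⇒> a≰b

double-suc : ∀ k → suc k + suc k ≡ suc (suc (k + k))
double-suc k = cong suc (+-suc k k)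

+-suc-suc : ∀ a b → a + suc (suc b) ≡ suc (suc (a + b))
+-suc-suc a b = trans (+-suc a (suc b)) (cong suc (+-suc a b))

room-after-round : ∀ k {x x′} → suc (suc k) + suc (suc k) ≤ x → x ≤ suc x′ → suc (suc k + suc k) ≤ x′
room-after-round k 2k+4≤x x≤ = ≤-pred (≤-trans (≤-reflexive (regroup k)) (≤-trans 2k+4≤x x≤))
  where
  regroup : ∀ k → suc (suc (suc k + suc k)) ≡ suc (suc k) + suc (suc k)
  regroup = solve-∀

Forces-mono : ∀ {m K K′ c r D} → K′ ≤ K → Forces m K c r D → Forces m K′ c r D
Forces-mono K′≤K (done K≤) = done (≤-trans K′≤K K≤)
Forces-mono {m} {K} {K′} {c} {r} {D} K′≤K (step c≢r reply) = step c≢r weakened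
  where
  weakened : ∀ c′ → Move c c′ →
             c′ ≢ r × Σ (Fin m) λ r′ → Move r r′ × r′ ≢ c′ × Forces m K′ c′ r′ (D ∪ ⁅ r ⁆)
  weakened c′ c→c′ with reply c′ c→c′
  ... | c′≢r , r′ , r→r′ , r′≢c′ , F = c′≢r , r′ , r→r′ , r′≢c′ , Forces-mono K′≤K F

Forces⇒Forces′ : ∀ {m K c r D} → Forces m K c r D → Forces′ m K c r D
Forces⇒Forces′ (done K≤) = done K≤
Forces⇒Forces′ {c = c} (step c≢r reply) with reply c (inj₁ refl)
... | _ , r′ , r→r′ , r′≢c , F = step c≢r (r′ , r→r′ , r′≢c , F)

capture : ∀ {m K c r D} → Move c r → ∣ D ∣ < K → ¬ Forces m K c r D
capture c→r ∣D∣<K (done K≤∣D∣) = <⇒≱ ∣D∣<K K≤∣D∣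
capture c→r ∣D∣<K (step c≢r reply) = proj₁ (reply _ c→r) refl

RobberForces-mono : ∀ {m K K′} → K′ ≤ K → RobberForces m K → RobberForces m K′
RobberForces-mono K′≤K forces c₀ = proj₁ (forces c₀) , Forces-mono K′≤K (proj₂ (forces c₀))

RobberForces⇒RobberForces′ : ∀ {m K} → RobberForces m K → RobberForces′ m K
RobberForces⇒RobberForces′ forces c₀ = proj₁ (forces c₀) , Forces⇒Forces′ (proj₂ (forces c₀))

IsDmg-unique : ∀ {m k a} → IsDmg m k → RobberForces m a → ¬ RobberForces m (suc a) → k ≡ a
IsDmg-unique {k = k} {a} (forces-k , ¬forces-k+1) forces-a ¬forces-a+1 with <-cmp k a
... | tri< k<a _ _ = ⊥-elim (¬forces-k+1 (RobberForces-mono k<a forces-a))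
... | tri≈ _ k≡a _ = k≡a
... | tri> _ _ a<k = ⊥-elim (¬forces-a+1 (RobberForces-mono a<k forces-k))

-- ⟨ L , R , x , y ⟩: the damaged arc reaches L steps behind and R steps ahead of the robber, and
-- the cop is x steps ahead of and y steps behind it.
record Offsets : Set where
  constructor ⟨_,_,_,_⟩
  field
    L R x y : ℕ

mirror : Offsets → Offsets
mirror ⟨ L , R , x , y ⟩ = ⟨ R , L , y , x ⟩

-- The robber's reply; in `forward` with R = 0 the robber leaves the arc, which grows by one.
data _↝_ : Offsets → Offsets → Set where
  stay     : ∀ {s} → s ↝ s
  forward  : ∀ {L R x y} → ⟨ L , R , suc x , y ⟩ ↝ ⟨ suc L , pred R , x , suc y ⟩
  backward : ∀ {L R x y} → ⟨ L , R , x , suc y ⟩ ↝ ⟨ pred L , suc R , suc x , y ⟩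

Far : Offsets → Set
Far ⟨ _ , _ , x , y ⟩ = 2 ≤ x × 2 ≤ y

arc-length : Offsets → ℕ
arc-length ⟨ L , R , _ , _ ⟩ = L + R

forward-potential : Offsets → ℕ
forward-potential ⟨ L , _ , x , _ ⟩ = L + L + x

Inv : ℕ → Offsets → Set
Inv B s = arc-length s < B × forward-potential s ≤ suc (B + B) × forward-potential (mirror s) ≤ suc (B + B)

inv-mirror : ∀ {B s} → Inv B s → Inv B (mirror s)
inv-mirror {B} {⟨ L , R , _ , _ ⟩} (size , fwd , bwd) = subst (_< B) (+-comm L R) size , bwd , fwd

module Bookkeeping (B : ℕ) where
  open ≤-Reasoning

  potentials-sum : ∀ {m} s → Offsets.x s + Offsets.y s ≡ m → m ≤ B + B + 2 → arc-length s < B →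
                   forward-potential s + forward-potential (mirror s) ≤ (B + B) + (B + B)
  potentials-sum {m} ⟨ L , R , x , y ⟩ x+y≡m m≤ size = +-cancelʳ-≤ 2 _ _ (begin
      (L + L + x) + (R + R + y) + 2          ≡⟨ regroup L R x y ⟩
      suc (L + R) + suc (L + R) + (x + y)    ≤⟨ +-mono-≤ (+-mono-≤ size size) (≤-trans (≤-reflexive x+y≡m) m≤) ⟩
      B + B + (B + B + 2)                    ≡⟨ +-assoc (B + B) (B + B) 2 ⟨
      (B + B) + (B + B) + 2                  ∎)
    where
    regroup : ∀ L R x y → (L + L + x) + (R + R + y) + 2 ≡ suc (L + R) + suc (L + R) + (x + y)
    regroup = solve-∀

  arc-can-grow : ∀ L z → 2 ≤ z → L + L + suc (suc z) ≤ suc (B + B) → suc (suc L) ≤ B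
  arc-can-grow L z 2≤z bound = half-≤ (suc (suc L)) B (begin
      suc (suc L) + suc (suc L)  ≡⟨ double L ⟩
      L + L + 4                  ≤⟨ +-monoʳ-≤ (L + L) (s≤s (s≤s 2≤z)) ⟩
      L + L + suc (suc z)        ≤⟨ bound ⟩
      suc (B + B)                ∎)
    where
    double : ∀ L → suc (suc L) + suc (suc L) ≡ L + L + 4
    double = solve-∀

  pass-forward : ∀ {L R x y} → L + R < B → L + L + suc x ≤ B + B → R + R + y ≤ B + B → 2 ≤ x →
                 Inv B ⟨ suc L , pred R , x , suc y ⟩
  pass-forward {L} {R} {x} {y} size fwd bwd 2≤x = size′ R size bwd , fwd′ , bwd′ R bwd
    where
    fwd′ : suc L + suc L + x ≤ suc (B + B)
    fwd′ = begin
      suc L + suc L + x        ≡⟨ cong (_+ x) (double-suc L) ⟩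
      suc (suc (L + L + x))    ≡⟨ cong suc (+-suc (L + L) x) ⟨
      suc (L + L + suc x)      ≤⟨ s≤s fwd ⟩
      suc (B + B)              ∎
    size′ : ∀ R → L + R < B → R + R + y ≤ B + B → suc L + pred R < B
    size′ zero _ _ = subst (_≤ B) (cong (suc ∘ suc) (sym (+-identityʳ L))) (arc-can-grow L x 2≤x (begin
      L + L + suc (suc x)      ≡⟨ +-suc (L + L) (suc x) ⟩
      suc (L + L + suc x)      ≤⟨ s≤s fwd ⟩
      suc (B + B)              ∎))
    size′ (suc R) size _ = subst (_< B) (+-suc L R) size
    bwd′ : ∀ R → R + R + y ≤ B + B → pred R + pred R + suc y ≤ suc (B + B)
    bwd′ zero bwd = s≤s bwd
    bwd′ (suc R) bwd = begin
      R + R + suc y            ≤⟨ n≤1+n _ ⟩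
      suc (R + R + suc y)      ≡⟨ cong suc (+-suc (R + R) y) ⟩
      suc (suc (R + R + y))    ≡⟨ cong (_+ y) (double-suc R) ⟨
      suc R + suc R + y        ≤⟨ m≤n⇒m≤1+n bwd ⟩
      suc (B + B)              ∎

  inv-after-pass : ∀ {s t} → arc-length s < B → forward-potential s ≤ B + B → forward-potential (mirror s) ≤ B + B →
                   s ↝ t → Far t → Inv B t
  inv-after-pass size fwd bwd stay _ = size , m≤n⇒m≤1+n fwd , m≤n⇒m≤1+n bwd
  inv-after-pass size fwd bwd forward (2≤x , _) = pass-forward size fwd bwd 2≤x
  inv-after-pass {⟨ L , R , x , suc y ⟩} size fwd bwd backward (_ , 2≤y) =
    inv-mirror {s = ⟨ suc R , pred L , y , suc x ⟩} (pass-forward (subst (_< B) (+-comm L R) size) bwd fwd 2≤y)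

  inv-after-advance : ∀ {L R x y t} → L + R < B → L + L + suc x ≤ suc (B + B) → suc (R + R + y) ≤ B + B →
                      ⟨ L , R , x , suc y ⟩ ↝ t → Far t → Inv B t
  inv-after-advance {L} {R} {x} {y} size fwd bwd stay _ =
    size , ≤-trans (+-monoʳ-≤ (L + L) (n≤1+n x)) fwd , ≤-trans (≤-reflexive (+-suc (R + R) y)) (m≤n⇒m≤1+n bwd)
  inv-after-advance {L} {R} {suc x} {y} size fwd bwd forward (2≤x , _) =
    size′ R size bwd ,
    ≤-trans (≤-reflexive (trans (cong (_+ x) (double-suc L)) (sym (+-suc-suc (L + L) x)))) fwd ,
    bwd′ R bwd
    where
    size′ : ∀ R → L + R < B → suc (R + R + y) ≤ B + B → suc L + pred R < B
    size′ zero _ _ = subst (_≤ B) (cong (suc ∘ suc) (sym (+-identityʳ L))) (arc-can-grow L x 2≤x fwd)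
    size′ (suc R) size _ = subst (_< B) (+-suc L R) size
    bwd′ : ∀ R → suc (R + R + y) ≤ B + B → pred R + pred R + suc (suc y) ≤ suc (B + B)
    bwd′ zero bwd = s≤s bwd
    bwd′ (suc R) bwd = begin
      R + R + suc (suc y)        ≡⟨ +-suc-suc (R + R) y ⟩
      suc (suc (R + R + y))      ≡⟨ cong (_+ y) (double-suc R) ⟨
      suc R + suc R + y          ≤⟨ m≤n⇒m≤1+n (≤-trans (n≤1+n _) bwd) ⟩
      suc (B + B)                ∎
  inv-after-advance {L} {R} {x} {y} size fwd bwd backward (_ , 2≤y) = size′ L size fwd , fwd′ L fwd , bwd′
    where
    bwd′ : suc R + suc R + y ≤ suc (B + B)
    bwd′ = ≤-trans (≤-reflexive (cong (_+ y) (double-suc R))) (s≤s bwd)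
    size′ : ∀ L → L + R < B → L + L + suc x ≤ suc (B + B) → pred L + suc R < B
    size′ zero _ _ = arc-can-grow R y 2≤y (≤-trans (≤-reflexive (+-suc-suc (R + R) y)) (s≤s bwd))
    size′ (suc L) size _ = subst (_< B) (sym (+-suc L R)) size
    fwd′ : ∀ L → L + L + suc x ≤ suc (B + B) → pred L + pred L + suc x ≤ suc (B + B)
    fwd′ zero fwd = fwd
    fwd′ (suc L) fwd = ≤-trans (+-monoˡ-≤ (suc x) (+-mono-≤ (n≤1+n L) (n≤1+n L))) fwd

  pursuit-bound : ∀ {P Q} → Q < P → P + Q ≤ (B + B) + (B + B) → suc Q ≤ B + B
  pursuit-bound {P} {Q} Q<P sum = half-≤ (suc Q) (B + B) (begin
    suc Q + suc Q          ≤⟨ +-monoˡ-≤ (suc Q) Q<P ⟩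
    P + suc Q              ≡⟨ +-suc P Q ⟩
    suc (P + Q)            ≤⟨ s≤s sum ⟩
    suc (B + B + (B + B))  ∎)

  balanced-bound : ∀ {P} → P + P ≤ (B + B) + (B + B) → P ≤ B + B
  balanced-bound {P} sum = half-≤ P (B + B) (m≤n⇒m≤1+n sum)

-- The cycle

module Cycle (n : ℕ) where

  M : ℕ
  M = suc n

  infixl 6 _⊕_
  _⊕_ : Fin M → ℕ → Fin M
  v ⊕ j = fromℕ< (m%n<n (toℕ v + j) M)

  toℕ-⊕ : ∀ v j → toℕ (v ⊕ j) ≡ (toℕ v + j) % M
  toℕ-⊕ v j = toℕ-fromℕ< _

  [m%M+n]%M≡[m+n]%M : ∀ a b → (a % M + b) % M ≡ (a + b) % M
  [m%M+n]%M≡[m+n]%M a b = begin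
      (a % M + b) % M             ≡⟨ %-distribˡ-+ (a % M) b M ⟩
      (a % M % M + b % M) % M     ≡⟨ cong (λ t → (t + b % M) % M) (m%n%n≡m%n a M) ⟩
      (a % M + b % M) % M         ≡⟨ %-distribˡ-+ a b M ⟨
      (a + b) % M                 ∎
    where open ≡-Reasoning

  ⊕-assoc : ∀ v i j → v ⊕ i ⊕ j ≡ v ⊕ (i + j)
  ⊕-assoc v i j = toℕ-injective (begin
      toℕ (v ⊕ i ⊕ j)            ≡⟨ toℕ-⊕ (v ⊕ i) j ⟩
      (toℕ (v ⊕ i) + j) % M      ≡⟨ cong (λ t → (t + j) % M) (toℕ-⊕ v i) ⟩
      ((toℕ v + i) % M + j) % M  ≡⟨ [m%M+n]%M≡[m+n]%M (toℕ v + i) j ⟩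
      (toℕ v + i + j) % M        ≡⟨ cong (_% M) (+-assoc (toℕ v) i j) ⟩
      (toℕ v + (i + j)) % M      ≡⟨ toℕ-⊕ v (i + j) ⟨
      toℕ (v ⊕ (i + j))          ∎)
    where open ≡-Reasoning

  ⊕-multiple : ∀ v j → v ⊕ j * M ≡ v
  ⊕-multiple v j =
    toℕ-injective (trans (toℕ-⊕ v (j * M)) (trans ([m+kn]%n≡m%n (toℕ v) j M) (m<n⇒m%n≡m (toℕ<n v))))

  ⊕-identityʳ : ∀ v → v ⊕ 0 ≡ v
  ⊕-identityʳ v = ⊕-multiple v 0

  ⊕-M : ∀ v → v ⊕ M ≡ v
  ⊕-M v = trans (cong (v ⊕_) (sym (*-identityˡ M))) (⊕-multiple v 1)

  offset : Fin M → Fin M → ℕ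
  offset u w = (toℕ w + (M ∸ toℕ u)) % M

  offset<M : ∀ u w → offset u w < M
  offset<M u w = m%n<n (toℕ w + (M ∸ toℕ u)) M

  ⊕-offset : ∀ u w → u ⊕ offset u w ≡ w
  ⊕-offset u w = toℕ-injective (begin
      toℕ (u ⊕ offset u w)                      ≡⟨ toℕ-⊕ u (offset u w) ⟩
      (toℕ u + offset u w) % M                  ≡⟨ cong (_% M) (+-comm (toℕ u) (offset u w)) ⟩
      (offset u w + toℕ u) % M                  ≡⟨ [m%M+n]%M≡[m+n]%M (toℕ w + (M ∸ toℕ u)) (toℕ u) ⟩
      (toℕ w + (M ∸ toℕ u) + toℕ u) % M         ≡⟨ cong (_% M) (+-assoc (toℕ w) (M ∸ toℕ u) (toℕ u)) ⟩
      (toℕ w + ((M ∸ toℕ u) + toℕ u)) % M       ≡⟨ cong (λ t → (toℕ w + t) % M) (m∸n+n≡m (<⇒≤ (toℕ<n u))) ⟩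
      (toℕ w + M) % M                           ≡⟨ [m+n]%n≡m%n (toℕ w) M ⟩
      toℕ w % M                                 ≡⟨ m<n⇒m%n≡m (toℕ<n w) ⟩
      toℕ w                                     ∎)
    where open ≡-Reasoning

  offset-⊕ : ∀ u i → i < M → offset u (u ⊕ i) ≡ i
  offset-⊕ u i i<M = begin
      (toℕ (u ⊕ i) + (M ∸ toℕ u)) % M           ≡⟨ cong (λ t → (t + (M ∸ toℕ u)) % M) (toℕ-⊕ u i) ⟩
      ((toℕ u + i) % M + (M ∸ toℕ u)) % M       ≡⟨ [m%M+n]%M≡[m+n]%M (toℕ u + i) (M ∸ toℕ u) ⟩
      (toℕ u + i + (M ∸ toℕ u)) % M             ≡⟨ cong (_% M) (regroup (toℕ u) i (M ∸ toℕ u)) ⟩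
      (i + ((M ∸ toℕ u) + toℕ u)) % M           ≡⟨ cong (λ t → (i + t) % M) (m∸n+n≡m (<⇒≤ (toℕ<n u))) ⟩
      (i + M) % M                               ≡⟨ [m+n]%n≡m%n i M ⟩
      i % M                                     ≡⟨ m<n⇒m%n≡m i<M ⟩
      i                                         ∎
    where
    open ≡-Reasoning
    regroup : ∀ a b c → a + b + c ≡ b + (c + a)
    regroup = solve-∀

  ⊕-≢ : ∀ v {i} → 0 < i → i < M → v ⊕ i ≢ v
  ⊕-≢ v {i} 0<i i<M v⊕i≡v = <⇒≢ 0<i (begin
      0                  ≡⟨ offset-⊕ v 0 (s≤s z≤n) ⟨
      offset v (v ⊕ 0)   ≡⟨ cong (offset v) (trans (⊕-identityʳ v) (sym v⊕i≡v)) ⟩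
      offset v (v ⊕ i)   ≡⟨ offset-⊕ v i i<M ⟩
      i                  ∎)
    where open ≡-Reasoning

  Adj-sym : ∀ {i j : Fin M} → Adj i j → Adj j i
  Adj-sym (inj₁ j≡1+i) = inj₂ (inj₁ j≡1+i)
  Adj-sym (inj₂ (inj₁ i≡1+j)) = inj₁ i≡1+j
  Adj-sym (inj₂ (inj₂ (inj₁ wrap))) = inj₂ (inj₂ (inj₂ wrap))
  Adj-sym (inj₂ (inj₂ (inj₂ wrap))) = inj₂ (inj₂ (inj₁ wrap))

  Move-sym : ∀ {i j : Fin M} → Move i j → Move j i
  Move-sym (inj₁ i≡j) = inj₁ (sym i≡j)
  Move-sym (inj₂ i~j) = inj₂ (Adj-sym i~j)

  ⊕1-unique : ∀ {i j} → (toℕ j ≡ suc (toℕ i)) ⊎ ((toℕ j ≡ 0) × (suc (toℕ i) ≡ M)) → j ≡ i ⊕ 1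
  ⊕1-unique {i} {j} (inj₁ j≡1+i) = toℕ-injective (begin
      toℕ j              ≡⟨ m<n⇒m%n≡m (toℕ<n j) ⟨
      toℕ j % M          ≡⟨ cong (_% M) (trans j≡1+i (+-comm 1 (toℕ i))) ⟩
      (toℕ i + 1) % M    ≡⟨ toℕ-⊕ i 1 ⟨
      toℕ (i ⊕ 1)        ∎)
    where open ≡-Reasoning
  ⊕1-unique {i} {j} (inj₂ (j≡0 , 1+i≡M)) = toℕ-injective (begin
      toℕ j              ≡⟨ j≡0 ⟩
      0                  ≡⟨ n%n≡0 M ⟨
      M % M              ≡⟨ cong (_% M) (trans (sym 1+i≡M) (+-comm 1 (toℕ i))) ⟩
      (toℕ i + 1) % M    ≡⟨ toℕ-⊕ i 1 ⟨
      toℕ (i ⊕ 1)        ∎)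
    where open ≡-Reasoning

  ⊕1⇒⊕n : ∀ {i j} → i ≡ j ⊕ 1 → j ≡ i ⊕ n
  ⊕1⇒⊕n {i} {j} i≡j⊕1 = sym (trans (cong (_⊕ n) i≡j⊕1) (trans (⊕-assoc j 1 n) (⊕-M j)))

  Move-⊕1 : ∀ v → Move v (v ⊕ 1)
  Move-⊕1 v with m≤n⇒m<n∨m≡n (toℕ<n v)
  ... | inj₁ 1+v<M = inj₂ (inj₁ (begin
      toℕ (v ⊕ 1)        ≡⟨ toℕ-⊕ v 1 ⟩
      (toℕ v + 1) % M    ≡⟨ cong (_% M) (+-comm (toℕ v) 1) ⟩
      suc (toℕ v) % M    ≡⟨ m<n⇒m%n≡m 1+v<M ⟩
      suc (toℕ v)        ∎))
    where open ≡-Reasoning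
  ... | inj₂ 1+v≡M = inj₂ (inj₂ (inj₂ (inj₂ (v⊕1≡0 , 1+v≡M))))
    where
    open ≡-Reasoning
    v⊕1≡0 : toℕ (v ⊕ 1) ≡ 0
    v⊕1≡0 = begin
      toℕ (v ⊕ 1)        ≡⟨ toℕ-⊕ v 1 ⟩
      (toℕ v + 1) % M    ≡⟨ cong (_% M) (trans (+-comm (toℕ v) 1) 1+v≡M) ⟩
      M % M              ≡⟨ n%n≡0 M ⟩
      0                  ∎

  Move-⊕n : ∀ v → Move v (v ⊕ n)
  Move-⊕n v = Move-sym (subst (Move (v ⊕ n)) v⊕n⊕1≡v (Move-⊕1 (v ⊕ n)))
    where
    v⊕n⊕1≡v : v ⊕ n ⊕ 1 ≡ v
    v⊕n⊕1≡v = trans (⊕-assoc v n 1) (trans (cong (v ⊕_) (+-comm n 1)) (⊕-M v))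

  neighbours : ∀ {c c′} → Move c c′ → c′ ≡ c ⊎ c′ ≡ c ⊕ 1 ⊎ c′ ≡ c ⊕ n
  neighbours (inj₁ c≡c′) = inj₁ (sym c≡c′)
  neighbours (inj₂ (inj₁ c′≡1+c)) = inj₂ (inj₁ (⊕1-unique (inj₁ c′≡1+c)))
  neighbours (inj₂ (inj₂ (inj₁ c≡1+c′))) = inj₂ (inj₂ (⊕1⇒⊕n (⊕1-unique (inj₁ c≡1+c′))))
  neighbours (inj₂ (inj₂ (inj₂ (inj₁ wrap)))) = inj₂ (inj₂ (⊕1⇒⊕n (⊕1-unique (inj₂ wrap))))
  neighbours (inj₂ (inj₂ (inj₂ (inj₂ wrap)))) = inj₂ (inj₁ (⊕1-unique (inj₂ wrap)))

  -- The two unit steps 1 and n ≡ -1 (mod M) in either order; j steps in direction a lead from v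
  -- to v ⊕ j * a.
  data Opposite : ℕ → ℕ → Set where
    clockwise     : Opposite 1 n
    anticlockwise : Opposite n 1

  opposite-sym : ∀ {a b} → Opposite a b → Opposite b a
  opposite-sym clockwise = anticlockwise
  opposite-sym anticlockwise = clockwise

  opposite-sum : ∀ {a b} → Opposite a b → a + b ≡ M
  opposite-sum clockwise = refl
  opposite-sum anticlockwise = +-comm n 1

  Move-step : ∀ {a b} → Opposite a b → ∀ v → Move v (v ⊕ a)
  Move-step clockwise = Move-⊕1
  Move-step anticlockwise = Move-⊕n

  Move-cases : ∀ {a b c c′} → Opposite a b → Move c c′ → c′ ≡ c ⊎ c′ ≡ c ⊕ a ⊎ c′ ≡ c ⊕ b
  Move-cases clockwise c→c′ = neighbours c→c′
  Move-cases anticlockwise c→c′ with neighbours c→c′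
  ... | inj₁ c′≡c = inj₁ c′≡c
  ... | inj₂ (inj₁ c′≡c⊕1) = inj₂ (inj₂ c′≡c⊕1)
  ... | inj₂ (inj₂ c′≡c⊕n) = inj₂ (inj₁ c′≡c⊕n)

  ⊕-cancel : ∀ {a b} → Opposite a b → ∀ v → v ⊕ a ⊕ b ≡ v
  ⊕-cancel {a} {b} o v = trans (⊕-assoc v a b) (trans (cong (v ⊕_) (opposite-sum o)) (⊕-M v))

  Move-back : ∀ {a b} → Opposite a b → ∀ v → Move (v ⊕ a) v
  Move-back o v = subst (Move _) (⊕-cancel o v) (Move-step (opposite-sym o) _)

  ⊕-steps-suc : ∀ v j a → v ⊕ j * a ⊕ a ≡ v ⊕ suc j * a
  ⊕-steps-suc v j a = trans (⊕-assoc v (j * a) a) (cong (v ⊕_) (+-comm (j * a) a))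

  ⊕-steps-cancel : ∀ {a b} → Opposite a b → ∀ v j → v ⊕ j * a ⊕ j * b ≡ v
  ⊕-steps-cancel {a} {b} o v j = begin
      v ⊕ j * a ⊕ j * b    ≡⟨ ⊕-assoc v (j * a) (j * b) ⟩
      v ⊕ (j * a + j * b)  ≡⟨ cong (v ⊕_) (*-distribˡ-+ j a b) ⟨
      v ⊕ j * (a + b)      ≡⟨ cong (λ t → v ⊕ j * t) (opposite-sum o) ⟩
      v ⊕ j * M            ≡⟨ ⊕-multiple v j ⟩
      v                    ∎
    where open ≡-Reasoning

  ⊕-steps-≢ : ∀ {a b} → Opposite a b → ∀ v {j} → 0 < j → j < M → v ⊕ j * a ≢ v
  ⊕-steps-≢ clockwise v {j} 0<j j<M = subst (_≢ v) (cong (v ⊕_) (sym (*-identityʳ j))) (⊕-≢ v 0<j j<M)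
  ⊕-steps-≢ anticlockwise v {j} 0<j j<M v⊕j*n≡v = ⊕-steps-≢ clockwise v 0<j j<M (begin
      v ⊕ j * 1            ≡⟨ cong (_⊕ j * 1) v⊕j*n≡v ⟨
      v ⊕ j * n ⊕ j * 1    ≡⟨ ⊕-steps-cancel anticlockwise v j ⟩
      v                    ∎)
    where open ≡-Reasoning

  record Gap (a b : ℕ) (r c : Fin M) (x y : ℕ) : Set where
    field
      ahead  : c ≡ r ⊕ x * a
      behind : c ≡ r ⊕ y * b
      total  : x + y ≡ M
  open Gap

  gap-mirror : ∀ {a b r c x y} → Gap a b r c x y → Gap b a r c y x
  gap-mirror {x = x} {y} G = record { ahead = behind G ; behind = ahead G ; total = trans (+-comm y x) (total G) }

  gap-from-ahead : ∀ {a b r c x y} → Opposite a b → c ≡ r ⊕ x * a → x + y ≡ M → Gap a b r c x y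
  gap-from-ahead {a} {b} {r} {c} {x} {y} o c≡r⊕xa x+y≡M =
    record { ahead = c≡r⊕xa ; behind = sym r⊕yb≡c ; total = x+y≡M }
    where
    open ≡-Reasoning
    r⊕yb≡c : r ⊕ y * b ≡ c
    r⊕yb≡c = begin
      r ⊕ y * b                 ≡⟨ cong (λ v → v ⊕ y * b) (⊕-steps-cancel o r x) ⟨
      r ⊕ x * a ⊕ x * b ⊕ y * b ≡⟨ cong (λ v → v ⊕ x * b ⊕ y * b) c≡r⊕xa ⟨
      c ⊕ x * b ⊕ y * b         ≡⟨ ⊕-assoc c (x * b) (y * b) ⟩
      c ⊕ (x * b + y * b)       ≡⟨ cong (c ⊕_) (*-distribʳ-+ b x y) ⟨
      c ⊕ (x + y) * b           ≡⟨ cong (λ t → c ⊕ t * b) x+y≡M ⟩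
      c ⊕ M * b                 ≡⟨ cong (c ⊕_) (*-comm M b) ⟩
      c ⊕ b * M                 ≡⟨ ⊕-multiple c b ⟩
      c                         ∎

  gap-cop-back : ∀ {a b r c x y} → Opposite a b → Gap a b r c (suc x) y → Gap a b r (c ⊕ b) x (suc y)
  gap-cop-back {a} {b} {r} {c} {x} {y} o G = gap-from-ahead o (begin
      c ⊕ b               ≡⟨ cong (_⊕ b) (ahead G) ⟩
      r ⊕ suc x * a ⊕ b   ≡⟨ cong (_⊕ b) (⊕-steps-suc r x a) ⟨
      r ⊕ x * a ⊕ a ⊕ b   ≡⟨ ⊕-cancel o (r ⊕ x * a) ⟩
      r ⊕ x * a           ∎) (trans (+-suc x y) (total G))
    where open ≡-Reasoning

  gap-robber-forward : ∀ {a b r c x y} → Opposite a b → Gap a b r c (suc x) y → Gap a b (r ⊕ a) c x (suc y)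
  gap-robber-forward {a} {r = r} {x = x} {y} o G =
    gap-from-ahead o (trans (ahead G) (sym (⊕-assoc r a (x * a)))) (trans (+-suc x y) (total G))

  gap-zero : ∀ {a b r c y} → Gap a b r c 0 y → c ≡ r
  gap-zero {r = r} G = trans (ahead G) (⊕-identityʳ r)

  gap-≢ : ∀ {a b r c x y} → Opposite a b → Gap a b r c x y → 0 < x → 0 < y → c ≢ r
  gap-≢ {r = r} {x = x} {y} o G 0<x 0<y c≡r = ⊕-steps-≢ o r 0<x x<M (trans (sym (ahead G)) c≡r)
    where
    x<M : x < M
    x<M = ≤-trans (≤-trans (≤-reflexive (+-comm 1 x)) (+-monoʳ-≤ x 0<y)) (≤-reflexive (total G))

  adjacent-or-far : ∀ {a b r c} x → Opposite a b → c ≡ r ⊕ x * a → c ≢ r → Move c r ⊎ 2 ≤ x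
  adjacent-or-far {r = r} zero _ c≡r⊕0 c≢r = ⊥-elim (c≢r (trans c≡r⊕0 (⊕-identityʳ r)))
  adjacent-or-far {a} {r = r} 1 o c≡r⊕a _ =
    inj₁ (subst (λ v → Move v r) (sym (trans c≡r⊕a (cong (r ⊕_) (+-identityʳ a)))) (Move-back o r))
  adjacent-or-far (suc (suc x)) _ _ _ = inj₂ (s≤s (s≤s z≤n))

  gap-cases : ∀ {a b r c x y} → Opposite a b → Gap a b r c x y → c ≢ r → Move c r ⊎ (2 ≤ x × 2 ≤ y)
  gap-cases {x = x} {y} o G c≢r
    with adjacent-or-far x o (ahead G) c≢r | adjacent-or-far y (opposite-sym o) (behind G) c≢r
  ... | inj₁ c→r | _ = inj₁ c→r
  ... | inj₂ _ | inj₁ c→r = inj₁ c→r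
  ... | inj₂ 2≤x | inj₂ 2≤y = inj₂ (2≤x , 2≤y)

  gap-exists : ∀ r c → Σ ℕ λ x → Σ ℕ λ y → Gap 1 n r c x y
  gap-exists r c = x , M ∸ x , gap-from-ahead clockwise c≡r⊕x (m+[n∸m]≡n (<⇒≤ (offset<M r c)))
    where
    x : ℕ
    x = offset r c
    c≡r⊕x : c ≡ r ⊕ x * 1
    c≡r⊕x = sym (trans (cong (r ⊕_) (*-identityʳ x)) (⊕-offset r c))

  gap-after-move : ∀ {a b r c c′ x y} → Opposite a b → Gap a b r c x y → c ≢ r → Move c c′ →
                   Σ ℕ λ x′ → Σ ℕ λ y′ → Gap a b r c′ x′ y′ × x ≤ suc x′ × y ≤ suc y′
  gap-after-move {x = zero} o G c≢r _ = ⊥-elim (c≢r (gap-zero G))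
  gap-after-move {y = zero} o G c≢r _ = ⊥-elim (c≢r (gap-zero (gap-mirror G)))
  gap-after-move {x = suc x} {suc y} o G c≢r c→c′ with Move-cases o c→c′
  ... | inj₁ refl = suc x , suc y , G , n≤1+n _ , n≤1+n _
  ... | inj₂ (inj₁ refl) =
    suc (suc x) , y , gap-mirror (gap-cop-back (opposite-sym o) (gap-mirror G)) , m≤n⇒m≤1+n (n≤1+n _) , ≤-refl
  ... | inj₂ (inj₂ refl) = x , suc (suc y) , gap-cop-back o G , ≤-refl , m≤n⇒m≤1+n (n≤1+n _)

  gap-<M : ∀ {a b r c x y} → Gap a b r c x y → c ≢ r → x < M
  gap-<M {y = zero} G c≢r = ⊥-elim (c≢r (gap-zero (gap-mirror G)))
  gap-<M {x = x} {suc y} G _ = subst (x <_) (total G) (m<m+n x (s≤s z≤n))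

  classify : ∀ c r → Move c r ⊎ Σ ℕ λ x → Σ ℕ λ y → Gap 1 n r c x y × 2 ≤ x × 2 ≤ y
  classify c r with c Fin.≟ r
  ... | yes c≡r = inj₁ (inj₁ c≡r)
  ... | no c≢r with gap-exists r c
  ...   | x , y , G with gap-cases clockwise G c≢r
  ...     | inj₁ c→r = inj₁ c→r
  ...     | inj₂ (2≤x , 2≤y) = inj₂ (x , y , G , 2≤x , 2≤y)

  v⊕0∈D∪⁅v⁆ : ∀ (D : Subset M) v → v ⊕ 0 ∈ D ∪ ⁅ v ⁆
  v⊕0∈D∪⁅v⁆ D v = subst (_∈ D ∪ ⁅ v ⁆) (sym (⊕-identityʳ v)) (q⊆p∪q D ⁅ v ⁆ (x∈⁅x⁆ v))

  record Arc (a b : ℕ) (r : Fin M) (D : Subset M) (L R : ℕ) : Set where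
    field
      trailing : ∀ {j} → j ≤ L → r ⊕ j * b ∈ D ∪ ⁅ r ⁆
      leading  : ∀ {j} → j ≤ R → r ⊕ j * a ∈ D ∪ ⁅ r ⁆
      size     : ∣ D ∪ ⁅ r ⁆ ∣ ≤ suc (L + R)
  open Arc

  arc-mirror : ∀ {a b r D L R} → Arc a b r D L R → Arc b a r D R L
  arc-mirror {r = r} {D} {L} {R} A = record
    { trailing = leading A
    ; leading  = trailing A
    ; size     = subst (λ t → ∣ D ∪ ⁅ r ⁆ ∣ ≤ suc t) (+-comm L R) (size A)
    }

  arc-init : ∀ {a b} r → Arc a b r ⊥ 0 0
  arc-init r = record
    { trailing = λ { z≤n → v⊕0∈D∪⁅v⁆ ⊥ r }
    ; leading  = λ { z≤n → v⊕0∈D∪⁅v⁆ ⊥ r }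
    ; size     = subst (λ t → ∣ ⊥ ∪ ⁅ r ⁆ ∣ ≤ suc t) (∣⊥∣≡0 M) (∣p∪⁅x⁆∣≤suc∣p∣ ⊥ r)
    }

  arc-stay : ∀ {a b r D L R} → Arc a b r D L R → Arc a b r (D ∪ ⁅ r ⁆) L R
  arc-stay {r = r} {D} A = record
    { trailing = λ j≤L → p⊆p∪q ⁅ r ⁆ (trailing A j≤L)
    ; leading  = λ j≤R → p⊆p∪q ⁅ r ⁆ (leading A j≤R)
    ; size     = ≤-trans (x∈p⇒∣p∪⁅x⁆∣≤∣p∣ (D ∪ ⁅ r ⁆) (q⊆p∪q D ⁅ r ⁆ (x∈⁅x⁆ r))) (size A)
    }

  arc-forward : ∀ {a b r D L R} → Opposite a b → Arc a b r D L R → Arc a b (r ⊕ a) (D ∪ ⁅ r ⁆) (suc L) (pred R)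
  arc-forward {a} {b} {r} {D} {L} {R} o A =
    record { trailing = trailing′ ; leading = leading′ ; size = size′ R (leading A) (size A) }
    where
    D′ : Subset M
    D′ = D ∪ ⁅ r ⁆
    trailing′ : ∀ {j} → j ≤ suc L → r ⊕ a ⊕ j * b ∈ D′ ∪ ⁅ r ⊕ a ⁆
    trailing′ {zero} _ = v⊕0∈D∪⁅v⁆ D′ (r ⊕ a)
    trailing′ {suc j} (s≤s j≤L) = p⊆p∪q ⁅ r ⊕ a ⁆ (subst (_∈ D′) (sym step-back) (trailing A j≤L))
      where
      step-back : r ⊕ a ⊕ suc j * b ≡ r ⊕ j * b
      step-back = trans (sym (⊕-assoc (r ⊕ a) b (j * b))) (cong (_⊕ j * b) (⊕-cancel o r))
    leading′ : ∀ {j} → j ≤ pred R → r ⊕ a ⊕ j * a ∈ D′ ∪ ⁅ r ⊕ a ⁆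
    leading′ {zero} _ = v⊕0∈D∪⁅v⁆ D′ (r ⊕ a)
    leading′ {suc j} j<R =
      p⊆p∪q ⁅ r ⊕ a ⁆ (subst (_∈ D′) (sym (⊕-assoc r a (suc j * a))) (leading A (within R j<R)))
      where
      within : ∀ R → suc j ≤ pred R → suc (suc j) ≤ R
      within (suc R) j<R = s≤s j<R
    size′ : ∀ R → (∀ {j} → j ≤ R → r ⊕ j * a ∈ D′) → ∣ D′ ∣ ≤ suc (L + R) →
            ∣ D′ ∪ ⁅ r ⊕ a ⁆ ∣ ≤ suc (suc L + pred R)
    size′ zero _ size = ≤-trans (∣p∪⁅x⁆∣≤suc∣p∣ D′ (r ⊕ a)) (s≤s size)
    size′ (suc R) leads size = begin
      ∣ D′ ∪ ⁅ r ⊕ a ⁆ ∣   ≤⟨ x∈p⇒∣p∪⁅x⁆∣≤∣p∣ D′ (subst (_∈ D′) (cong (r ⊕_) (*-identityˡ a)) (leads (s≤s z≤n))) ⟩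
      ∣ D′ ∣               ≤⟨ size ⟩
      suc (L + suc R)      ≡⟨ cong suc (+-suc L R) ⟩
      suc (suc L + R)      ∎
      where open ≤-Reasoning

  -- The cop's strategy

  Tracking : ℕ → ℕ → Fin M → Fin M → Subset M → Offsets → Set
  Tracking a b c r D ⟨ L , R , x , y ⟩ = Gap a b r c x y × Arc a b r D L R

  tracking-mirror : ∀ {a b c r D} s → Tracking a b c r D s → Tracking b a c r D (mirror s)
  tracking-mirror _ (G , A) = gap-mirror G , arc-mirror A

  respond-forward : ∀ {a b c r D L R x y} → Opposite a b → Tracking a b c r D ⟨ L , R , suc x , y ⟩ →
                    Tracking a b c (r ⊕ a) (D ∪ ⁅ r ⁆) ⟨ suc L , pred R , x , suc y ⟩
  respond-forward o (G , A) = gap-robber-forward o G , arc-forward o A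

  respond : ∀ {a b c r r′ D} s → Opposite a b → Tracking a b c r D s → c ≢ r → Move r r′ →
            Σ Offsets λ t → s ↝ t × Tracking a b c r′ (D ∪ ⁅ r ⁆) t
  respond ⟨ _ , _ , zero , _ ⟩ o (G , _) c≢r _ = ⊥-elim (c≢r (gap-zero G))
  respond ⟨ _ , _ , _ , zero ⟩ o (G , _) c≢r _ = ⊥-elim (c≢r (gap-zero (gap-mirror G)))
  respond s@(⟨ L , R , suc x , suc y ⟩) o T c≢r r→r′ with Move-cases o r→r′
  ... | inj₁ refl = s , stay , proj₁ T , arc-stay (proj₂ T)
  ... | inj₂ (inj₁ refl) = _ , forward , respond-forward o T
  ... | inj₂ (inj₂ refl) =
    _ , backward , tracking-mirror _ (respond-forward (opposite-sym o) (tracking-mirror s T))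

  module CopStrategy (B : ℕ) (M≤ : M ≤ B + B + 2) where
    open Bookkeeping B

    damage-bound : ∀ {a b r D L R} → Arc a b r D L R → L + R < B → ∣ D ∪ ⁅ r ⁆ ∣ ≤ B
    damage-bound A L+R<B = ≤-trans (size A) L+R<B

    unreached : ∀ {a b r D L R} → Arc a b r D L R → L + R < B → ¬ (suc B ≤ ∣ D ∣)
    unreached {r = r} {D} A L+R<B B<∣D∣ = <⇒≱ B<∣D∣ (≤-trans (∣p∣≤∣p∪q∣ D ⁅ r ⁆) (damage-bound A L+R<B))

    mutual
      cop-wins : ∀ {a b c r D} s → Opposite a b → Tracking a b c r D s → Far s → Inv B s →
                 ¬ Forces M (suc B) c r D
      cop-wins s o T far I F with <-cmp (forward-potential (mirror s)) (forward-potential s)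
      ... | tri< Q<P _ _ = cop-advances s o T far I Q<P F
      ... | tri≈ _ Q≡P _ = cop-waits s o T I Q≡P F
      ... | tri> _ _ P<Q =
        cop-advances (mirror s) (opposite-sym o) (tracking-mirror s T) (swap far) (inv-mirror {s = s} I) P<Q F

      cop-advances : ∀ {a b c r D} s → Opposite a b → Tracking a b c r D s → Far s → Inv B s →
                     forward-potential (mirror s) < forward-potential s → ¬ Forces M (suc B) c r D
      cop-advances ⟨ _ , _ , zero , _ ⟩ _ _ (() , _) _ _ _
      cop-advances ⟨ L , R , suc x , y ⟩ o (G , A) _ (size , _) _ (done B<∣D∣) = unreached A size B<∣D∣
      cop-advances {b = b} {c} ⟨ L , R , suc x , y ⟩ o (G , A) _ (size , fwd , _) Q<P (step _ reply)
        with reply (c ⊕ b) (Move-step (opposite-sym o) c)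
      ... | c′≢r , r′ , r→r′ , r′≢c′ , F′ with respond ⟨ L , R , x , suc y ⟩ o (gap-cop-back o G , A) c′≢r r→r′
      ...   | t , s↝t , T′ = continue t o T′ (≢-sym r′≢c′) (damage-bound A size) (inv-after-advance size fwd bwd s↝t) F′
        where
        bwd : suc (R + R + y) ≤ B + B
        bwd = pursuit-bound Q<P (potentials-sum ⟨ L , R , suc x , y ⟩ (total G) M≤ size)

      cop-waits : ∀ {a b c r D} s → Opposite a b → Tracking a b c r D s → Inv B s →
                  forward-potential (mirror s) ≡ forward-potential s → ¬ Forces M (suc B) c r D
      cop-waits ⟨ L , R , x , y ⟩ o (G , A) (size , _) _ (done B<∣D∣) = unreached A size B<∣D∣
      cop-waits {c = c} s@(⟨ L , R , x , y ⟩) o (G , A) (size , _) Q≡P (step _ reply) with reply c (inj₁ refl)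
      ... | c≢r , r′ , r→r′ , r′≢c , F′ with respond s o (G , A) c≢r r→r′
      ...   | t , s↝t , T′ = continue t o T′ (≢-sym r′≢c) (damage-bound A size) (inv-after-pass size P≤ Q≤ s↝t) F′
        where
        sum : L + L + x + (R + R + y) ≤ (B + B) + (B + B)
        sum = potentials-sum s (total G) M≤ size
        P≤ : L + L + x ≤ B + B
        P≤ = balanced-bound (subst (λ Q → L + L + x + Q ≤ (B + B) + (B + B)) Q≡P sum)
        Q≤ : R + R + y ≤ B + B
        Q≤ = subst (_≤ B + B) (sym Q≡P) P≤

      continue : ∀ {a b c r D} s → Opposite a b → Tracking a b c r D s → c ≢ r → ∣ D ∣ ≤ B →
                 (Far s → Inv B s) → ¬ Forces M (suc B) c r D
      continue s o (G , A) c≢r ∣D∣≤B inv F with gap-cases o G c≢r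
      ... | inj₁ c→r = capture c→r (s≤s ∣D∣≤B) F
      ... | inj₂ far = cop-wins s o (G , A) far (inv far) F

    -- The bounds are needed only once the robber is known not to start on the cop.
    primed-cop-wins : ∀ {r₀ c₀ x y} → Gap 1 n r₀ c₀ x y → (c₀ ≢ r₀ → x ≤ B + B × y ≤ B + B) →
                      ¬ Forces′ M (suc B) c₀ r₀ ⊥
    primed-cop-wins _ _ (done B<∣⊥∣) = <⇒≱ B<∣⊥∣ (≤-trans (≤-reflexive (∣⊥∣≡0 M)) z≤n)
    primed-cop-wins {r₀} {c₀} {x} {y} G bounds (step c₀≢r₀ (r₁ , r₀→r₁ , r₁≢c₀ , F))
      with respond ⟨ 0 , 0 , x , y ⟩ clockwise (G , arc-init r₀) c₀≢r₀ r₀→r₁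
    ... | t , s↝t , T′ =
      continue t clockwise T′ (≢-sym r₁≢c₀) (damage-bound (arc-init {1} {n} r₀) 0<B)
        (inv-after-pass 0<B x≤ y≤ s↝t) F
      where
      x≤ : x ≤ B + B
      x≤ = proj₁ (bounds c₀≢r₀)
      y≤ : y ≤ B + B
      y≤ = proj₂ (bounds c₀≢r₀)
      0<B : 0 < B
      0<B = n≢0⇒n>0 λ B≡0 → 0≢1+n (begin
        0       ≡⟨ cong₂ _+_ (n≤0⇒n≡0 (subst (λ b → x ≤ b + b) B≡0 x≤))
                             (n≤0⇒n≡0 (subst (λ b → y ≤ b + b) B≡0 y≤)) ⟨
        x + y   ≡⟨ total G ⟩
        M       ∎)
        where open ≡-Reasoning

  primed-far-bound : ∀ {B r₀ c₀ x y} → M ≤ B + B + 2 → Gap 1 n r₀ c₀ x y → 2 ≤ x → 2 ≤ y →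
                     ¬ Forces′ M (suc B) c₀ r₀ ⊥
  primed-far-bound {B} {x = x} {y} M≤ G 2≤x 2≤y =
    CopStrategy.primed-cop-wins B M≤ G λ _ →
      other-side x y (total G) 2≤y , other-side y x (trans (+-comm y x) (total G)) 2≤x
    where
    other-side : ∀ u v → u + v ≡ M → 2 ≤ v → u ≤ B + B
    other-side u v u+v≡M 2≤v =
      +-cancelʳ-≤ 2 u (B + B) (≤-trans (+-monoʳ-≤ u 2≤v) (≤-trans (≤-reflexive u+v≡M) M≤))

  primed-bound : ∀ {B} → M ≤ suc (B + B) → ¬ RobberForces′ M (suc B)
  primed-bound {B} M≤ forces with forces Fin.zero
  ... | r₀ , F′ with gap-exists r₀ Fin.zero
  ...   | x , y , G = CopStrategy.primed-cop-wins B M≤′ G bounds F′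
    where
    M≤′ : M ≤ B + B + 2
    M≤′ = ≤-trans M≤ (≤-trans (n≤1+n _) (≤-reflexive (+-comm 2 (B + B))))
    bounds : Fin.zero ≢ r₀ → x ≤ B + B × y ≤ B + B
    bounds 0≢r₀ = ≤-pred (≤-trans (gap-<M G 0≢r₀) M≤) , ≤-pred (≤-trans (gap-<M (gap-mirror G) 0≢r₀) M≤)

  dmg-upper : ∀ {B} → M ≤ B + B + 2 → ¬ RobberForces M (suc B)
  dmg-upper {B} M≤ forces with forces Fin.zero
  ... | r₀ , F with classify Fin.zero r₀
  ...   | inj₁ 0→r₀ = capture 0→r₀ (subst (_< suc B) (sym (∣⊥∣≡0 M)) (s≤s z≤n)) F
  ...   | inj₂ (_ , _ , G , 2≤x , 2≤y) = primed-far-bound M≤ G 2≤x 2≤y (Forces⇒Forces′ F)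

  primed-nonadjacent-bound : ∀ {B} → M ≤ B + B + 2 → ∀ c₀ r₀ → ¬ Adj c₀ r₀ → ¬ Forces′ M (suc B) c₀ r₀ ⊥
  primed-nonadjacent-bound {B} M≤ c₀ r₀ ¬adj with classify c₀ r₀
  ... | inj₁ (inj₂ adj) = ⊥-elim (¬adj adj)
  ... | inj₂ (_ , _ , G , 2≤x , 2≤y) = primed-far-bound M≤ G 2≤x 2≤y
  ... | inj₁ (inj₁ c₀≡r₀) with gap-exists r₀ c₀
  ...   | _ , _ , G = CopStrategy.primed-cop-wins B M≤ G (λ c₀≢r₀ → ⊥-elim (c₀≢r₀ c₀≡r₀))

  -- The robber's strategies

  trail : ℕ → Fin M → ℕ → Subset M
  trail a r zero = ⊥
  trail a r (suc k) = ⁅ r ⁆ ∪ trail a (r ⊕ a) k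

  trail-∈ : ∀ {a v r k} → v ∈ trail a r k → Σ ℕ λ j → j < k × v ≡ r ⊕ j * a
  trail-∈ {k = zero} v∈ = ⊥-elim (∉⊥ v∈)
  trail-∈ {a} {v} {r} {suc k} v∈ with x∈p∪q⁻ ⁅ r ⁆ (trail a (r ⊕ a) k) v∈
  ... | inj₁ v∈⁅r⁆ = 0 , s≤s z≤n , trans (x∈⁅y⁆⇒x≡y r v∈⁅r⁆) (sym (⊕-identityʳ r))
  ... | inj₂ v∈T with trail-∈ v∈T
  ...   | j , j<k , v≡ = suc j , s≤s j<k , trans v≡ (⊕-assoc r a (j * a))

  ∈-trail : ∀ {a r k j} → j < k → r ⊕ j * a ∈ trail a r k
  ∈-trail {a} {r} {suc k} {zero} _ =
    p⊆p∪q (trail a (r ⊕ a) k) (subst (_∈ ⁅ r ⁆) (sym (⊕-identityʳ r)) (x∈⁅x⁆ r))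
  ∈-trail {a} {r} {suc k} {suc j} (s≤s j<k) =
    q⊆p∪q ⁅ r ⁆ (trail a (r ⊕ a) k) (subst (_∈ trail a (r ⊕ a) k) (⊕-assoc r a (j * a)) (∈-trail j<k))

  start∉trail : ∀ {a b} → Opposite a b → ∀ v {k} → k < M → v ∉ trail a (v ⊕ a) k
  start∉trail {a} o v k<M v∈ with trail-∈ v∈
  ... | j , j<k , v≡ = ⊕-steps-≢ o v (s≤s z≤n) (≤-trans (s≤s j<k) k<M) (sym (trans v≡ (⊕-assoc v a (j * a))))

  trail-size : ∀ {a b} → Opposite a b → ∀ r {k} → k ≤ M → k ≤ ∣ trail a r k ∣
  trail-size o r {zero} _ = z≤n
  trail-size {a} o r {suc k} k<M = begin
      suc k                      ≤⟨ s≤s (trail-size o (r ⊕ a) (≤-trans (n≤1+n k) k<M)) ⟩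
      suc ∣ T ∣                  ≤⟨ p⊂q⇒∣p∣<∣q∣ (q⊆p∪q ⁅ r ⁆ T , r , p⊆p∪q T (x∈⁅x⁆ r) , start∉trail o r k<M) ⟩
      ∣ ⁅ r ⁆ ∪ T ∣              ∎
    where
    open ≤-Reasoning
    T : Subset M
    T = trail a (r ⊕ a) k

  RobberReply : ℕ → Fin M → Fin M → Subset M → Set
  RobberReply K c r D = Σ (Fin M) λ r′ → Move r r′ × r′ ≢ c × Forces M K c r′ (D ∪ ⁅ r ⁆)

  stay-put : ∀ {a K c r D} → c ≢ r → K ≤ ∣ D ∪ trail a r 1 ∣ → RobberReply K c r D
  stay-put {r = r} {D} c≢r K≤ =
    r , inj₁ refl , ≢-sym c≢r , done (subst (λ S → _ ≤ ∣ D ∪ S ∣) (∪-identityʳ ⁅ r ⁆) K≤)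

  flee : ∀ {a b c r D x y K} k → Opposite a b → Gap a b r c x y → 2 ≤ y → k + k ≤ x → K ≤ ∣ D ∪ trail a r k ∣ →
         Forces M K c r D
  flee {D = D} {K = K} zero _ _ _ _ K≤ = done (subst (λ S → K ≤ ∣ S ∣) (∪-identityʳ D) K≤)
  flee {a} {b} {c} {r} {D} {x} {y} {K} (suc k) o G 2≤y 2k≤x K≤ = step c≢r reply
    where
    2≤x : 2 ≤ x
    2≤x = ≤-trans (≤-trans (s≤s (s≤s z≤n)) (≤-reflexive (sym (double-suc k)))) 2k≤x
    c≢r : c ≢ r
    c≢r = gap-≢ o G (≤-trans (s≤s z≤n) 2≤x) (≤-trans (s≤s z≤n) 2≤y)
    reply : ∀ c′ → Move c c′ → c′ ≢ r × RobberReply K c′ r D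
    reply c′ c→c′ with gap-after-move o G c≢r c→c′
    ... | x′ , y′ , G′ , x≤ , y≤ = c′≢r , run k x′ G′ x≤ 2k≤x K≤
      where
      0<y′ : 0 < y′
      0<y′ = ≤-pred (≤-trans 2≤y y≤)
      c′≢r : c′ ≢ r
      c′≢r = gap-≢ o G′ (≤-pred (≤-trans 2≤x x≤)) 0<y′
      run : ∀ k x′ → Gap a b r c′ x′ y′ → x ≤ suc x′ → suc k + suc k ≤ x → K ≤ ∣ D ∪ trail a r (suc k) ∣ →
            RobberReply K c′ r D
      run zero _ _ _ _ K≤ = stay-put {a} c′≢r K≤
      run (suc k) zero _ x≤ 2k≤x _ with room-after-round k 2k≤x x≤
      ... | ()
      run (suc k) (suc x″) G′ x≤ 2k≤x K≤ =
        r ⊕ a , Move-step o r , ≢-sym (gap-≢ o G″ (≤-trans (s≤s z≤n) room) (s≤s z≤n)) ,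
        flee (suc k) o G″ (s≤s 0<y′) room (subst (λ S → K ≤ ∣ S ∣) (sym (∪-assoc D ⁅ r ⁆ _)) K≤)
        where
        room : suc k + suc k ≤ x″
        room = ≤-pred (room-after-round k 2k≤x x≤)
        G″ : Gap a b (r ⊕ a) c′ x″ (suc y′)
        G″ = gap-robber-forward o G′

  x∈q⇒p∪⁅x⁆⊆p∪q : ∀ {v} (X T : Subset M) → v ∈ T → X ∪ ⁅ v ⁆ ⊆ X ∪ T
  x∈q⇒p∪⁅x⁆⊆p∪q {v} X T v∈T w∈ with x∈p∪q⁻ X ⁅ v ⁆ w∈
  ... | inj₁ w∈X = p⊆p∪q T w∈X
  ... | inj₂ w∈⁅v⁆ = q⊆p∪q X T (subst (_∈ T) (sym (x∈⁅y⁆⇒x≡y v w∈⁅v⁆)) v∈T)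

  doubling-back-gains : ∀ {a} D r {g} T → g ∉ D ∪ trail a r 2 → g ∈ T →
                        ∣ D ∪ trail a r 2 ∣ ≤ ∣ (D ∪ ⁅ r ⁆) ∪ T ∣
  doubling-back-gains {a} D r {g} T g∉ g∈T = begin
      ∣ D ∪ trail a r 2 ∣                    ≡⟨ cong ∣_∣ (∪-assoc D ⁅ r ⁆ (⁅ r ⊕ a ⁆ ∪ ⊥)) ⟨
      ∣ (D ∪ ⁅ r ⁆) ∪ (⁅ r ⊕ a ⁆ ∪ ⊥) ∣      ≡⟨ cong (λ S → ∣ (D ∪ ⁅ r ⁆) ∪ S ∣) (∪-identityʳ ⁅ r ⊕ a ⁆) ⟩
      ∣ (D ∪ ⁅ r ⁆) ∪ ⁅ r ⊕ a ⁆ ∣            ≤⟨ ∣p∪⁅x⁆∣≤suc∣p∣ (D ∪ ⁅ r ⁆) (r ⊕ a) ⟩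
      suc ∣ D ∪ ⁅ r ⁆ ∣                      ≤⟨ x∉p⇒∣p∣<∣p∪⁅x⁆∣ (D ∪ ⁅ r ⁆) g∉D∪⁅r⁆ ⟩
      ∣ (D ∪ ⁅ r ⁆) ∪ ⁅ g ⁆ ∣                ≤⟨ p⊆q⇒∣p∣≤∣q∣ (x∈q⇒p∪⁅x⁆⊆p∪q (D ∪ ⁅ r ⁆) T g∈T) ⟩
      ∣ (D ∪ ⁅ r ⁆) ∪ T ∣                    ∎
    where
    open ≤-Reasoning
    g∉D∪⁅r⁆ : g ∉ D ∪ ⁅ r ⁆
    g∉D∪⁅r⁆ g∈ = g∉ (subst (g ∈_) (∪-assoc D ⁅ r ⁆ (trail a (r ⊕ a) 1)) (p⊆p∪q (trail a (r ⊕ a) 1) g∈))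

  -- g is the undamaged vertex p steps behind the robber, to which it returns when the cop, coming
  -- round the other way, gets two steps ahead of it.
  module DoubleBack (A : ℕ) (M≡ : M ≡ suc (A + A)) where

    room-behind : ∀ p y → 2 + suc y ≡ M → p + 2 ≡ suc A → p + p ≡ y
    room-behind p y 3+y≡M p+2≡1+A = +-cancelʳ-≡ 4 (p + p) y (begin
        p + p + 4           ≡⟨ regroup p ⟩
        (p + 2) + (p + 2)   ≡⟨ cong₂ _+_ p+2≡1+A p+2≡1+A ⟩
        suc A + suc A       ≡⟨ cong suc (+-suc A A) ⟩
        suc (suc (A + A))   ≡⟨ cong suc (trans (sym M≡) (sym 3+y≡M)) ⟩
        suc (2 + suc y)     ≡⟨ +-comm 4 y ⟩
        y + 4               ∎)
      where
      open ≡-Reasoning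
      regroup : ∀ p → p + p + 4 ≡ (p + 2) + (p + 2)
      regroup = solve-∀

    double-back : ∀ {a b r c g D y K} p → Opposite a b → Gap a b r c 2 (suc y) → r ≡ g ⊕ p * a → p + 2 ≡ suc A →
                  g ∉ D ∪ trail a r 2 → K ≤ ∣ D ∪ trail a r 2 ∣ → RobberReply K c r D
    double-back {a} {r = r} {g = g} {D} zero _ _ r≡g⊕0 _ g∉ _ =
      ⊥-elim (g∉ (subst (_∈ D ∪ trail a r 2) (trans r≡g⊕0 (⊕-identityʳ g)) r∈))
      where
      r∈ : r ∈ D ∪ trail a r 2
      r∈ = q⊆p∪q D (trail a r 2) (p⊆p∪q (trail a (r ⊕ a) 1) (x∈⁅x⁆ r))
    double-back {a} {b} {r} {c} {g} {D} {y} (suc p) o G r≡ p+2≡ g∉ K≤ =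
      r ⊕ b , Move-step (opposite-sym o) r , ≢-sym (gap-≢ (opposite-sym o) G′ (subst (0 <_) 2p≡y (s≤s z≤n)) (s≤s z≤n)) ,
      flee (suc p) (opposite-sym o) G′ (s≤s (s≤s z≤n)) (≤-reflexive 2p≡y)
        (≤-trans K≤ (doubling-back-gains D r T g∉ g∈T))
      where
      open ≡-Reasoning
      G′ : Gap b a (r ⊕ b) c y 3
      G′ = gap-robber-forward (opposite-sym o) (gap-mirror G)
      2p≡y : suc p + suc p ≡ y
      2p≡y = room-behind (suc p) y (total G) p+2≡
      T : Subset M
      T = trail b (r ⊕ b) (suc p)
      g∈T : g ∈ T
      g∈T = subst (_∈ T) (begin
        r ⊕ b ⊕ p * b                ≡⟨ ⊕-assoc r b (p * b) ⟩
        r ⊕ suc p * b                ≡⟨ cong (_⊕ suc p * b) r≡ ⟩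
        g ⊕ suc p * a ⊕ suc p * b    ≡⟨ ⊕-steps-cancel o g (suc p) ⟩
        g                            ∎) (∈-trail (n<1+n p))

    flee-or-double-back : ∀ {a b c r g D x y K} k p → Opposite a b → Gap a b r c x y → 2 ≤ x → 2 ≤ y →
                          k + k ≤ suc x → r ≡ g ⊕ p * a → p + k ≡ suc A →
                          g ∉ D ∪ trail a r k → K ≤ ∣ D ∪ trail a r k ∣ → Forces M K c r D
    flee-or-double-back {D = D} {K = K} zero _ _ _ _ _ _ _ _ _ K≤ =
      done (subst (λ S → K ≤ ∣ S ∣) (∪-identityʳ D) K≤)
    flee-or-double-back {a} {b} {c} {r} {g} {D} {x} {y} {K} (suc k) p o G 2≤x 2≤y 2k≤x r≡ p+k≡ g∉ K≤ =
      step c≢r reply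
      where
      c≢r : c ≢ r
      c≢r = gap-≢ o G (≤-trans (s≤s z≤n) 2≤x) (≤-trans (s≤s z≤n) 2≤y)
      reply : ∀ c′ → Move c c′ → c′ ≢ r × RobberReply K c′ r D
      reply c′ c→c′ with gap-after-move o G c≢r c→c′
      ... | x′ , y′ , G′ , x≤ , y≤ = c′≢r , answer k x′ y′ G′ x≤ (≤-pred (≤-trans 2≤y y≤)) 2k≤x p+k≡ g∉ K≤
        where
        c′≢r : c′ ≢ r
        c′≢r = gap-≢ o G′ (≤-pred (≤-trans 2≤x x≤)) (≤-pred (≤-trans 2≤y y≤))
        answer : ∀ k x′ y′ → Gap a b r c′ x′ y′ → x ≤ suc x′ → 0 < y′ → suc k + suc k ≤ suc x →
                 p + suc k ≡ suc A → g ∉ D ∪ trail a r (suc k) → K ≤ ∣ D ∪ trail a r (suc k) ∣ → RobberReply K c′ r D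
        answer zero _ _ _ _ _ _ _ _ K≤ = stay-put {a} c′≢r K≤
        answer (suc k) (suc (suc (suc x′))) y′ G′ x≤ 0<y′ 2k≤x p+k≡ g∉ K≤ =
          r ⊕ a , Move-step o r , ≢-sym (gap-≢ o G″ (s≤s z≤n) (s≤s z≤n)) ,
          flee-or-double-back (suc k) (suc p) o G″ (s≤s (s≤s z≤n)) (s≤s 0<y′)
            (≤-pred (room-after-round k 2k≤x (s≤s x≤)))
            (trans (cong (_⊕ a) r≡) (⊕-steps-suc g p a)) (trans (sym (+-suc p (suc k))) p+k≡)
            (subst (g ∉_) (sym (∪-assoc D ⁅ r ⁆ _)) g∉) (subst (λ S → K ≤ ∣ S ∣) (sym (∪-assoc D ⁅ r ⁆ _)) K≤)
          where
          G″ : Gap a b (r ⊕ a) c′ (suc (suc x′)) (suc y′)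
          G″ = gap-robber-forward o G′
        answer (suc zero) 2 (suc y′) G′ _ _ _ p+2≡ g∉ K≤ = double-back p o G′ r≡ p+2≡ g∉ K≤
        answer (suc k) 0 _ _ x≤ _ 2k≤x _ _ _ with room-after-round k 2k≤x (s≤s x≤)
        ... | s≤s ()
        answer (suc k) 1 _ _ x≤ _ 2k≤x _ _ _
          with subst (λ t → suc t ≤ 2) (double-suc k) (room-after-round k 2k≤x (s≤s x≤))
        ... | s≤s (s≤s ())
        answer (suc (suc k)) 2 _ _ x≤ _ 2k≤x _ _ _
          with subst (λ t → suc t ≤ 3) (double-suc (suc k)) (room-after-round (suc k) 2k≤x (s≤s x≤))
        ... | s≤s (s≤s (s≤s ()))

  gap-two-ahead : ∀ {c x} → x + 2 ≡ M → Gap 1 n (c ⊕ 1 ⊕ 1) c x 2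
  gap-two-ahead {c} {x} x+2≡M =
    gap-mirror (gap-from-ahead anticlockwise (sym c⊕2⊕2n≡c) (trans (+-comm 2 x) x+2≡M))
    where
    c⊕2⊕2n≡c : c ⊕ 1 ⊕ 1 ⊕ 2 * n ≡ c
    c⊕2⊕2n≡c = trans (cong (_⊕ 2 * n) (⊕-assoc c 1 1)) (⊕-steps-cancel clockwise c 2)

  ⊥∪trail-size : ∀ r {k} → k ≤ M → k ≤ ∣ ⊥ ∪ trail 1 r k ∣
  ⊥∪trail-size r {k} k≤M =
    subst (λ S → k ≤ ∣ S ∣) (sym (∪-identityˡ (trail 1 r k))) (trail-size clockwise r k≤M)

  dmg-lower-even : ∀ {a} → M ≡ 2 + (a + a) → RobberForces M a
  dmg-lower-even {a} M≡ c₀ =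
    c₀ ⊕ 1 ⊕ 1 , flee a clockwise (gap-two-ahead (trans (+-comm (a + a) 2) (sym M≡))) ≤-refl ≤-refl
                   (⊥∪trail-size (c₀ ⊕ 1 ⊕ 1) a≤M)
    where
    a≤M : a ≤ M
    a≤M = ≤-trans (m≤m+n a a) (≤-trans (m≤n+m (a + a) 2) (≤-reflexive (sym M≡)))

  primed-lower-even : ∀ {a} → M ≡ 2 + (a + a) → 1 ≤ a → RobberForces′ M (suc a)
  primed-lower-even {a} M≡ 1≤a c₀ =
    r₀ , step c₀≢r₀ (r₁ , Move-⊕1 r₀ , ≢-sym c₀≢r₁ , flee a clockwise G ≤-refl ≤-refl bound)
    where
    r₀ r₁ : Fin M
    r₀ = c₀ ⊕ 1
    r₁ = r₀ ⊕ 1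
    G : Gap 1 n r₁ c₀ (a + a) 2
    G = gap-two-ahead (trans (+-comm (a + a) 2) (sym M≡))
    c₀≢r₀ : c₀ ≢ r₀
    c₀≢r₀ c₀≡r₀ = ⊕-≢ c₀ (s≤s z≤n) (subst (1 <_) (sym M≡) (s≤s (s≤s z≤n))) (sym c₀≡r₀)
    c₀≢r₁ : c₀ ≢ r₁
    c₀≢r₁ = gap-≢ clockwise G (≤-trans 1≤a (m≤m+n a a)) (s≤s z≤n)
    bound : suc a ≤ ∣ (⊥ ∪ ⁅ r₀ ⁆) ∪ trail 1 r₁ a ∣
    bound = subst (λ S → suc a ≤ ∣ S ∣) (sym (∪-assoc ⊥ ⁅ r₀ ⁆ (trail 1 r₁ a))) (⊥∪trail-size r₀ 1+a≤M)
      where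
      1+a≤M : suc a ≤ M
      1+a≤M = ≤-trans (s≤s (m≤m+n a a)) (≤-trans (m≤n+m (suc (a + a)) 1) (≤-reflexive (sym M≡)))

  dmg-lower-odd : ∀ {A} → M ≡ suc (A + A) → 2 ≤ A → RobberForces M A
  dmg-lower-odd {suc A} M≡ (s≤s 1≤A) c₀ =
    c₀ ⊕ 1 ⊕ 1 , flee-or-double-back (suc A) 1 clockwise (gap-two-ahead x+2≡M) (s≤s (≤-trans 1≤A (m≤m+n A A)))
                   ≤-refl (≤-reflexive (double-suc A)) refl refl g∉ (⊥∪trail-size (c₀ ⊕ 1 ⊕ 1) A≤M)
    where
    open DoubleBack (suc A) M≡
    A≤M : suc A ≤ M
    A≤M = ≤-trans (m≤m+n (suc A) (suc A)) (≤-trans (n≤1+n _) (≤-reflexive (sym M≡)))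
    x+2≡M : suc (A + A) + 2 ≡ M
    x+2≡M = trans (regroup A) (sym M≡)
      where
      regroup : ∀ A → suc (A + A) + 2 ≡ suc (suc A + suc A)
      regroup = solve-∀
    g∉ : c₀ ⊕ 1 ∉ ⊥ ∪ trail 1 (c₀ ⊕ 1 ⊕ 1) (suc A)
    g∉ g∈ = start∉trail clockwise (c₀ ⊕ 1) (subst (suc A <_) (sym M≡) (s≤s (m≤m+n (suc A) (suc A))))
              (subst (c₀ ⊕ 1 ∈_) (∪-identityˡ _) g∈)

  odd-case : ∀ {A k} → M ≡ suc (A + A) → 2 ≤ A → IsDmg M k → IsDmg′ M k
  odd-case {A} {k} M≡ 2≤A isDmg =
    RobberForces⇒RobberForces′ (proj₁ isDmg) ,
    subst (λ j → ¬ RobberForces′ M (suc j)) (sym k≡A) (primed-bound (≤-reflexive M≡))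
    where
    M≤ : M ≤ A + A + 2
    M≤ = ≤-trans (≤-reflexive M≡) (≤-trans (n≤1+n _) (≤-reflexive (+-comm 2 (A + A))))
    k≡A : k ≡ A
    k≡A = IsDmg-unique isDmg (dmg-lower-odd M≡ 2≤A) (dmg-upper M≤)

  even-case : ∀ {a k} → M ≡ 2 + (a + a) → 1 ≤ a → IsDmg M k →
              IsDmg′ M (suc k) × (∀ c₀ r₀ → ¬ Adj c₀ r₀ → ¬ Forces′ M (suc k) c₀ r₀ ⊥)
  even-case {a} {k} M≡ 1≤a isDmg =
    subst (λ j → IsDmg′ M (suc j) × (∀ c₀ r₀ → ¬ Adj c₀ r₀ → ¬ Forces′ M (suc j) c₀ r₀ ⊥)) (sym k≡a)
      ((primed-lower-even M≡ 1≤a , primed-bound M≤′) , primed-nonadjacent-bound M≤)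
    where
    M≤ : M ≤ a + a + 2
    M≤ = ≤-reflexive (trans M≡ (+-comm 2 (a + a)))
    M≤′ : M ≤ suc (suc a + suc a)
    M≤′ = ≤-trans (≤-reflexive M≡) (≤-trans (n≤1+n _) (≤-reflexive (cong suc (sym (double-suc a)))))
    k≡a : k ≡ a
    k≡a = IsDmg-unique isDmg (dmg-lower-even M≡) (dmg-upper M≤)

m≡m%2+[m/2+m/2] : ∀ m → m ≡ m % 2 + (m / 2 + m / 2)
m≡m%2+[m/2+m/2] m = trans (m≡m%n+[m/n]*n m 2) (cong (m % 2 +_) (twice (m / 2)))
  where
  twice : ∀ a → a * 2 ≡ a + a
  twice = solve-∀

odd-half : ∀ {m a} → 4 ≤ m → m ≡ suc (a + a) → 2 ≤ a
odd-half {a = zero} (s≤s ()) refl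
odd-half {a = suc zero} (s≤s (s≤s (s≤s ()))) refl
odd-half {a = suc (suc a)} _ _ = s≤s (s≤s z≤n)

even-half : ∀ {m a} → 4 ≤ m → m ≡ a + a → Σ ℕ λ a′ → m ≡ 2 + (a′ + a′) × 1 ≤ a′
even-half {a = zero} () refl
even-half {a = suc zero} (s≤s (s≤s ())) refl
even-half {a = suc (suc a)} _ refl = suc a , double-suc (suc a) , s≤s z≤n

lemma18 : ∀ (m k : ℕ) → 4 ≤ m → IsDmg m k →
    ((m % 2 ≡ 1) → IsDmg′ m k)
    × ((m % 2 ≡ 0) → IsDmg′ m (suc k)
        × (∀ (c0 r0 : Fin m) → ¬ Adj c0 r0 → ¬ Forces′ m (suc k) c0 r0 ⊥))
lemma18 (suc n) k 4≤m isDmg = odd , even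
  where
  open Cycle n
  odd : suc n % 2 ≡ 1 → IsDmg′ M k
  odd m%2≡1 = odd-case M≡ (odd-half {a = M / 2} 4≤m M≡) isDmg
    where
    M≡ : M ≡ suc (M / 2 + M / 2)
    M≡ = trans (m≡m%2+[m/2+m/2] M) (cong (_+ (M / 2 + M / 2)) m%2≡1)
  even : suc n % 2 ≡ 0 → IsDmg′ M (suc k) × (∀ c₀ r₀ → ¬ Adj c₀ r₀ → ¬ Forces′ M (suc k) c₀ r₀ ⊥)
  even m%2≡0 with even-half {a = M / 2} 4≤m (trans (m≡m%2+[m/2+m/2] M) (cong (_+ (M / 2 + M / 2)) m%2≡0))
  ... | a , M≡ , 1≤a = even-case M≡ 1≤a isDmg
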